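{- Let $M$ be a connected simple matroid of rank $3$ on $E$ with rank function $r$. Then for every flat $F$ of $M$ with $r(F)=2$ and $|F|\ge 3$, the inequality $(F,2)_\le$ is a facet-defining inequality of $\mathcal{B}(M)$.
   Context: $(A,a)_\le=\{I\subseteq E:|I\cap A|\le a\}$, $(A,a)_==\{I\subseteq E:|I\cap A|=a\}$. $\mathcal{B}(M)$ is the family of bases. A face of $\mathcal{B}(M)$ is $\mathcal{B}(M)\cap\bigcap_i(A_i,r(A_i))_=$; a facet is a maximal proper face; $(F,r(F))_\le$ is facet-defining if $\mathcal{B}(M)\cap(F,r(F))_=$ is a facet. -}

module Defs where

open import Data.Nat using (ℕ; suc; _+_; _≤_; _<_)
open import Data.Fin using (Fin)
open import Data.Fin.Subset
  using (Subset; ⊤; ∁; _∩_; _∪_; ⁅_⁆; _⊆_; _∉_; ∣_∣; Nonempty)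
open import Data.List using (List)
open import Data.List.Relation.Unary.All using (All)
open import Data.Product using (Σ; ∃; _×_)
open import Relation.Binary.PropositionalEquality using (_≡_; _≢_)
open import Relation.Nullary using (¬_)

-- A matroid on the ground set E = Fin n, given by its rank function
-- (rank axioms R1–R3; nonnegativity is automatic in ℕ).
record Matroid (n : ℕ) : Set where
  field
    r          : Subset n → ℕ
    r-bounded  : ∀ X → r X ≤ ∣ X ∣
    r-mono     : ∀ X Y → X ⊆ Y → r X ≤ r Y
    r-submod   : ∀ X Y → r (X ∪ Y) + r (X ∩ Y) ≤ r X + r Y

module _ {n : ℕ} (M : Matroid n) where
  open Matroid M

  rankM : ℕ
  rankM = r ⊤

  Independent : Subset n → Set
  Independent I = r I ≡ ∣ I ∣

  IsBasis : Subset n → Set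
  IsBasis B = Independent B × ∣ B ∣ ≡ r ⊤

  Simple : Set
  Simple = (∀ e → r ⁅ e ⁆ ≡ 1) × (∀ e f → e ≢ f → r (⁅ e ⁆ ∪ ⁅ f ⁆) ≡ 2)

  Connected : Set
  Connected = ∀ A → Nonempty A → Nonempty (∁ A) → r A + r (∁ A) ≢ r ⊤

  IsFlat : Subset n → Set
  IsFlat F = ∀ e → e ∉ F → r F < r (F ∪ ⁅ e ⁆)

  Family : Set₁
  Family = Subset n → Set

  _⊑_ : Family → Family → Set
  𝒢 ⊑ ℋ = ∀ B → 𝒢 B → ℋ B

  -- a face: 𝓑(M) ∩ ⋂_i (A_i, r(A_i))_=  for a finite list of sets A_i
  IsFace : Family → Set
  IsFace 𝒢 = Σ (List (Subset n)) λ As →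
    ∀ B → (𝒢 B → IsBasis B × All (λ A → ∣ B ∩ A ∣ ≡ r A) As)
        × (IsBasis B × All (λ A → ∣ B ∩ A ∣ ≡ r A) As → 𝒢 B)

  IsProperFace : Family → Set
  IsProperFace 𝒢 = IsFace 𝒢 × ¬ (IsBasis ⊑ 𝒢)

  IsFacet : Family → Set₁
  IsFacet 𝒢 = IsProperFace 𝒢 × (∀ ℋ → IsProperFace ℋ → 𝒢 ⊑ ℋ → ℋ ⊑ 𝒢)

  -- (F, r(F))_≤ is facet-defining: 𝓑(M) ∩ (F, r(F))_= is a facet
  FacetDefining : Subset n → Set₁
  FacetDefining F = IsFacet (λ B → IsBasis B × ∣ B ∩ F ∣ ≡ r F)

module Submission where

-- It is proper:
-- connectedness forces r(E ∖ F) ≥ 2, so E ∖ F has two elements c ≠ d, and by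
-- submodularity one of {c, d, a}, {c, d, a'} (a ≠ a' in F) is a basis meeting F
-- only once. For maximality the key fact is that every 3-set meeting F in exactly
-- two points lies in G, because any two points of F span the flat F. Exchanging
-- single elements between such triples shows that a set A whose inequality
-- (A, r(A))_≤ is tight on G has constant membership on F and on E ∖ F, so A is
-- ∅, E or F (E ∖ F is excluded since its rank is at least 2). A proper face
-- containing G is cut out by such sets; ∅ and E are tight on every basis, so
-- properness forces F among them and the face is contained in G.

open import Defs
open import Data.Nat using (ℕ; zero; suc; _+_; _≤_; _<_; s≤s; z≤n; _≟_)
open import Data.Nat.Properties
open import Data.Bool using (Bool; true; false; if_then_else_)
open import Data.Fin using (Fin; zero; suc)
open import Data.Fin.Properties using (any?)
open import Data.Fin.Subset
open import Data.Fin.Subset.Properties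
open import Data.Vec using (_∷_; []; lookup; here; there)
open import Data.Vec.Properties using ([]=⇒lookup; lookup⇒[]=; tabulate∘lookup; tabulate-cong)
open import Data.List using (List; _∷_; [])
open import Data.List.Relation.Unary.All using (All; _∷_; [])
import Data.List.Relation.Unary.All as All
open import Data.List.Membership.Propositional using () renaming (_∈_ to _∈ₗ_)
open import Data.Product using (∃; _×_; _,_; proj₁; proj₂)
open import Data.Sum using (_⊎_; inj₁; inj₂; [_,_]′)
open import Function using (_∘_; id)
open import Relation.Nullary using (¬_; yes; no; contradiction)
open import Relation.Nullary.Decidable using (decidable-stable; ¬?; _×-dec_)
open import Relation.Binary.PropositionalEquality

private variable
  n : ℕ

𝟙 : Subset n → Fin n → ℕ
𝟙 A x = if lookup A x then 1 else 0

𝟙-∈ : ∀ {A : Subset n} {x} → x ∈ A → 𝟙 A x ≡ 1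
𝟙-∈ x∈A rewrite []=⇒lookup x∈A = refl

lookup-∉ : ∀ {A : Subset n} {x} → x ∉ A → lookup A x ≡ false
lookup-∉ {A = A} {x} x∉A with lookup A x in eq
... | true  = contradiction (lookup⇒[]= x A eq) x∉A
... | false = refl

𝟙-∉ : ∀ {A : Subset n} {x} → x ∉ A → 𝟙 A x ≡ 0
𝟙-∉ x∉A rewrite lookup-∉ x∉A = refl

𝟙-injective : ∀ {A : Subset n} {x y} → 𝟙 A x ≡ 𝟙 A y → lookup A x ≡ lookup A y
𝟙-injective {A = A} {x} {y} eq with lookup A x | lookup A y
... | true  | true  = refl
... | false | false = refl

count-insert : (p A : Subset n) (x : Fin n) → x ∉ p →
               ∣ (p ∪ ⁅ x ⁆) ∩ A ∣ ≡ ∣ p ∩ A ∣ + 𝟙 A x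
count-insert (true  ∷ p) A           zero    x∉p = contradiction here x∉p
count-insert (false ∷ p) (true  ∷ A) zero    x∉p
  rewrite ∪-identityʳ p = sym (+-comm ∣ p ∩ A ∣ 1)
count-insert (false ∷ p) (false ∷ A) zero    x∉p
  rewrite ∪-identityʳ p = sym (+-identityʳ ∣ p ∩ A ∣)
count-insert (true  ∷ p) (true  ∷ A) (suc x) x∉p = cong suc (count-insert p A x (x∉p ∘ there))
count-insert (true  ∷ p) (false ∷ A) (suc x) x∉p = count-insert p A x (x∉p ∘ there)
count-insert (false ∷ p) (true  ∷ A) (suc x) x∉p = count-insert p A x (x∉p ∘ there)
count-insert (false ∷ p) (false ∷ A) (suc x) x∉p = count-insert p A x (x∉p ∘ there)

triple : Fin n → Fin n → Fin n → Subset n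
triple x y z = (⁅ x ⁆ ∪ ⁅ y ⁆) ∪ ⁅ z ⁆

⁅⁆-⊆ : {x : Fin n} {S : Subset n} → x ∈ S → ⁅ x ⁆ ⊆ S
⁅⁆-⊆ {x = x} x∈S y∈⁅x⁆ rewrite x∈⁅y⁆⇒x≡y x y∈⁅x⁆ = x∈S

∪-⊆ : {p q S : Subset n} → p ⊆ S → q ⊆ S → p ∪ q ⊆ S
∪-⊆ {p = p} {q} p⊆S q⊆S x∈p∪q = [ p⊆S , q⊆S ]′ (x∈p∪q⁻ p q x∈p∪q)

∉-pair : {x y z : Fin n} → z ≢ x → z ≢ y → z ∉ ⁅ x ⁆ ∪ ⁅ y ⁆
∉-pair {x = x} {y} z≢x z≢y z∈xy =
  [ z≢x ∘ x∈⁅y⁆⇒x≡y x , z≢y ∘ x∈⁅y⁆⇒x≡y y ]′ (x∈p∪q⁻ ⁅ x ⁆ ⁅ y ⁆ z∈xy)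

triple-⊆ : {x y z : Fin n} {S : Subset n} → x ∈ S → y ∈ S → z ∈ S → triple x y z ⊆ S
triple-⊆ x∈S y∈S z∈S = ∪-⊆ (∪-⊆ (⁅⁆-⊆ x∈S) (⁅⁆-⊆ y∈S)) (⁅⁆-⊆ z∈S)

first∈triple : {x y z : Fin n} → x ∈ triple x y z
first∈triple {x = x} {y} {z} = p⊆p∪q ⁅ z ⁆ (p⊆p∪q ⁅ y ⁆ (x∈⁅x⁆ x))

third∈triple : {x y z : Fin n} → z ∈ triple x y z
third∈triple {x = x} {y} {z} = q⊆p∪q (⁅ x ⁆ ∪ ⁅ y ⁆) ⁅ z ⁆ (x∈⁅x⁆ z)

count-triple : (A : Subset n) {x y z : Fin n} → x ≢ y → x ≢ z → y ≢ z →
               ∣ triple x y z ∩ A ∣ ≡ 𝟙 A x + 𝟙 A y + 𝟙 A z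
count-triple {n} A {x} {y} {z} x≢y x≢z y≢z = begin
  ∣ triple x y z ∩ A ∣                ≡⟨ count-insert (⁅ x ⁆ ∪ ⁅ y ⁆) A z (∉-pair (x≢z ∘ sym) (y≢z ∘ sym)) ⟩
  ∣ (⁅ x ⁆ ∪ ⁅ y ⁆) ∩ A ∣ + 𝟙 A z     ≡⟨ cong (_+ 𝟙 A z) (count-insert ⁅ x ⁆ A y (x≢y⇒x∉⁅y⁆ (x≢y ∘ sym))) ⟩
  ∣ ⁅ x ⁆ ∩ A ∣ + 𝟙 A y + 𝟙 A z       ≡⟨ cong (λ k → k + 𝟙 A y + 𝟙 A z) count-single ⟩
  𝟙 A x + 𝟙 A y + 𝟙 A z               ∎
  where
  open ≡-Reasoning
  count-single : ∣ ⁅ x ⁆ ∩ A ∣ ≡ 𝟙 A x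
  count-single = begin
    ∣ ⁅ x ⁆ ∩ A ∣           ≡⟨ cong (λ s → ∣ s ∩ A ∣) (∪-identityˡ ⁅ x ⁆) ⟨
    ∣ (⊥ ∪ ⁅ x ⁆) ∩ A ∣     ≡⟨ count-insert ⊥ A x ∉⊥ ⟩
    ∣ ⊥ ∩ A ∣ + 𝟙 A x       ≡⟨ cong (λ s → ∣ s ∣ + 𝟙 A x) (∩-zeroˡ A) ⟩
    ∣ ⊥ {n} ∣ + 𝟙 A x       ≡⟨ cong (_+ 𝟙 A x) (∣⊥∣≡0 n) ⟩
    𝟙 A x                   ∎

size-triple : {x y z : Fin n} → x ≢ y → x ≢ z → y ≢ z → ∣ triple x y z ∣ ≡ 3
size-triple {n} {x} {y} {z} x≢y x≢z y≢z = begin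
  ∣ triple x y z ∣                   ≡⟨ cong ∣_∣ (∩-identityʳ (triple x y z)) ⟨
  ∣ triple x y z ∩ ⊤ ∣               ≡⟨ count-triple ⊤ x≢y x≢z y≢z ⟩
  𝟙 ⊤ x + 𝟙 ⊤ y + 𝟙 ⊤ z              ≡⟨ cong₂ _+_ (cong₂ _+_ (𝟙-∈ {x = x} ∈⊤) (𝟙-∈ {x = y} ∈⊤)) (𝟙-∈ {x = z} ∈⊤) ⟩
  3                                  ∎
  where open ≡-Reasoning

∣p∪q∣≤∣p∣+∣q∣ : (p q : Subset n) → ∣ p ∪ q ∣ ≤ ∣ p ∣ + ∣ q ∣
∣p∪q∣≤∣p∣+∣q∣ []          []          = z≤n
∣p∪q∣≤∣p∣+∣q∣ (true  ∷ p) (false ∷ q) = s≤s (∣p∪q∣≤∣p∣+∣q∣ p q)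
∣p∪q∣≤∣p∣+∣q∣ (true  ∷ p) (true  ∷ q) = s≤s (≤-trans (∣p∪q∣≤∣p∣+∣q∣ p q) (+-monoʳ-≤ ∣ p ∣ (n≤1+n ∣ q ∣)))
∣p∪q∣≤∣p∣+∣q∣ (false ∷ p) (false ∷ q) = ∣p∪q∣≤∣p∣+∣q∣ p q
∣p∪q∣≤∣p∣+∣q∣ (false ∷ p) (true  ∷ q) =
  subst (suc ∣ p ∪ q ∣ ≤_) (sym (+-suc ∣ p ∣ ∣ q ∣)) (s≤s (∣p∪q∣≤∣p∣+∣q∣ p q))

pick-outside : (p q : Subset n) → ∣ q ∣ < ∣ p ∣ → ∃ λ x → x ∈ p × x ∉ q
pick-outside p q ∣q∣<∣p∣ with any? (λ x → x ∈? p ×-dec ¬? (x ∈? q))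
... | yes found = found
... | no  none  = contradiction (p⊆q⇒∣p∣≤∣q∣ p⊆q) (<⇒≱ ∣q∣<∣p∣)
  where
  p⊆q : p ⊆ q
  p⊆q {x} x∈p = decidable-stable (x ∈? q) (λ x∉q → none (x , x∈p , x∉q))

size-nonempty : (p : Subset n) → 0 < ∣ p ∣ → Nonempty p
size-nonempty {n} p 0<∣p∣ with pick-outside p ⊥ (subst (_< ∣ p ∣) (sym (∣⊥∣≡0 n)) 0<∣p∣)
... | x , x∈p , _ = x , x∈p

∣pair∣≤2 : (x y : Fin n) → ∣ ⁅ x ⁆ ∪ ⁅ y ⁆ ∣ ≤ 2
∣pair∣≤2 x y = subst₂ (λ i j → ∣ ⁅ x ⁆ ∪ ⁅ y ⁆ ∣ ≤ i + j) (∣⁅x⁆∣≡1 x) (∣⁅x⁆∣≡1 y)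
                 (∣p∪q∣≤∣p∣+∣q∣ ⁅ x ⁆ ⁅ y ⁆)

pick-third : (p : Subset n) (x y : Fin n) → 3 ≤ ∣ p ∣ → ∃ λ z → z ∈ p × z ≢ x × z ≢ y
pick-third p x y 3≤∣p∣ with pick-outside p (⁅ x ⁆ ∪ ⁅ y ⁆) (≤-trans (s≤s (∣pair∣≤2 x y)) 3≤∣p∣)
... | z , z∈p , z∉xy = z , z∈p , x∉⁅y⁆⇒x≢y (z∉xy ∘ p⊆p∪q ⁅ y ⁆)
                                , x∉⁅y⁆⇒x≢y (z∉xy ∘ q⊆p∪q ⁅ x ⁆ ⁅ y ⁆)

lookup-ext : {A B : Subset n} → (∀ x → lookup A x ≡ lookup B x) → A ≡ B
lookup-ext {A = A} {B} same =
  trans (sym (tabulate∘lookup A)) (trans (tabulate-cong same) (tabulate∘lookup B))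

Profile : Subset n → Subset n → Bool → Bool → Set
Profile F A α β = (∀ x → x ∈ F → lookup A x ≡ α) × (∀ x → x ∉ F → lookup A x ≡ β)

profile-unique : ∀ {F A B : Subset n} {α β} → Profile F A α β → Profile F B α β → A ≡ B
profile-unique {F = F} {A} {B} (onA , offA) (onB , offB) = lookup-ext same
  where
  same : ∀ x → lookup A x ≡ lookup B x
  same x with x ∈? F
  ... | yes x∈F = trans (onA x x∈F) (sym (onB x x∈F))
  ... | no  x∉F = trans (offA x x∉F) (sym (offB x x∉F))

profile-classify : (F A : Subset n) (α β : Bool) → Profile F A α β →
                   A ≡ ⊥ ⊎ A ≡ ⊤ ⊎ A ≡ F ⊎ A ≡ ∁ F
profile-classify F A false false pA =
  inj₁ (profile-unique pA ((λ x _ → lookup-∉ {A = ⊥} {x} ∉⊥) , (λ x _ → lookup-∉ {A = ⊥} {x} ∉⊥)))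
profile-classify F A true true pA =
  inj₂ (inj₁ (profile-unique pA ((λ x _ → []=⇒lookup (∈⊤ {x = x})) , (λ x _ → []=⇒lookup (∈⊤ {x = x})))))
profile-classify F A true false pA =
  inj₂ (inj₂ (inj₁ (profile-unique pA ((λ _ → []=⇒lookup) , (λ _ → lookup-∉)))))
profile-classify F A false true pA =
  inj₂ (inj₂ (inj₂ (profile-unique pA ((λ _ → lookup-∉ ∘ x∈p⇒x∉∁p) , (λ _ → []=⇒lookup ∘ x∉p⇒x∈∁p)))))

all-or-witness : ∀ {a} {A : Set a} {P : Set} {Q : A → Set} {xs : List A} →
                 All (λ x → P ⊎ Q x) xs → P ⊎ All Q xs
all-or-witness []                = inj₂ []
all-or-witness (inj₁ p  ∷ _)     = inj₁ p
all-or-witness (inj₂ qx ∷ rest)  with all-or-witness rest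
... | inj₁ p   = inj₁ p
... | inj₂ qxs = inj₂ (qx ∷ qxs)

module MatroidFacts (M : Matroid n) where
  open Matroid M

  r-⊥ : r ⊥ ≡ 0
  r-⊥ = n≤0⇒n≡0 (subst (r ⊥ ≤_) (∣⊥∣≡0 n) (r-bounded ⊥))

  flat-growth : ∀ {F T z} → IsFlat M F → r F ≤ r (T ∩ F) → z ∈ T → z ∉ F → r F < r T
  flat-growth {F} {T} {z} flat spans z∈T z∉F = +-cancelʳ-< (r F) (r F) (r T) (begin-strict
    r F + r F              <⟨ +-mono-<-≤ grows spans ⟩
    r (T ∪ F) + r (T ∩ F)  ≤⟨ r-submod T F ⟩
    r T + r F              ∎)
    where
    open ≤-Reasoning
    grows : r F < r (T ∪ F)
    grows = <-≤-trans (flat z z∉F) (r-mono _ _ (∪-⊆ (q⊆p∪q T F) (⁅⁆-⊆ (p⊆p∪q F z∈T))))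

  simple-rank≥2 : Simple M → ∀ {X} → 2 ≤ ∣ X ∣ → 2 ≤ r X
  simple-rank≥2 (_ , r-pair) {X} 2≤∣X∣ with size-nonempty X (≤-trans (n≤1+n 1) 2≤∣X∣)
  ... | x , x∈X
    with pick-outside X ⁅ x ⁆ (subst (_< ∣ X ∣) (sym (∣⁅x⁆∣≡1 x)) 2≤∣X∣)
  ... | y , y∈X , y∉x = subst (_≤ r X) (r-pair x y (x∉⁅y⁆⇒x≢y y∉x ∘ sym))
                          (r-mono _ _ (∪-⊆ (⁅⁆-⊆ x∈X) (⁅⁆-⊆ y∈X)))

  connected-complement : Connected M → ∀ {A} → Nonempty A → Nonempty (∁ A) → r ⊤ < r A + r (∁ A)
  connected-complement conn {A} ne ne∁ = ≤∧≢⇒< r⊤≤ (conn A ne ne∁ ∘ sym)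
    where
    r⊤≤ : r ⊤ ≤ r A + r (∁ A)
    r⊤≤ = m+n≤o⇒m≤o (r ⊤) (subst (λ S → r S + r (A ∩ ∁ A) ≤ r A + r (∁ A)) (p∪∁p≡⊤ A) (r-submod A (∁ A)))

  complement-nonempty : ∀ {A} → r A < r ⊤ → Nonempty (∁ A)
  complement-nonempty {A} rA<r⊤ with nonempty? (∁ A)
  ... | yes ne = ne
  ... | no  empty = contradiction (r-mono ⊤ A ⊤⊆A) (<⇒≱ rA<r⊤)
    where
    ⊤⊆A : ⊤ ⊆ A
    ⊤⊆A {x} _ = x∉∁p⇒x∈p (λ x∈∁A → ∉⊥ (subst (x ∈_) (Empty-unique empty) x∈∁A))

module RankTwoFlat (M : Matroid n) (connected : Connected M) (simple : Simple M)
                   (r⊤≡3 : rankM M ≡ 3) (F : Subset n) (flat : IsFlat M F)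
                   (rF≡2 : Matroid.r M F ≡ 2) (3≤∣F∣ : 3 ≤ ∣ F ∣) where
  open Matroid M
  open MatroidFacts M

  Tight : Subset n → Subset n → Set
  Tight B A = ∣ B ∩ A ∣ ≡ r A

  G : Family M
  G B = IsBasis M B × Tight B F

  TightOnG : Subset n → Set
  TightOnG A = ∀ B → G B → Tight B A

  separated : ∀ {x z} → x ∈ F → z ∉ F → x ≢ z
  separated x∈F z∉F refl = z∉F x∈F

  three-two∈G : ∀ {T} → ∣ T ∣ ≡ 3 → ∣ T ∩ F ∣ ≡ 2 → G T
  three-two∈G {T} ∣T∣≡3 ∣T∩F∣≡2
    with pick-outside T (T ∩ F) (subst₂ _<_ (sym ∣T∩F∣≡2) (sym ∣T∣≡3) ≤-refl)
  ... | z , z∈T , z∉T∩F = (independent , trans ∣T∣≡3 (sym r⊤≡3)) , trans ∣T∩F∣≡2 (sym rF≡2)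
    where
    spans : r F ≤ r (T ∩ F)
    spans = subst (_≤ r (T ∩ F)) (sym rF≡2) (simple-rank≥2 simple (≤-reflexive (sym ∣T∩F∣≡2)))
    r-grows : r F < r T
    r-grows = flat-growth flat spans z∈T (λ z∈F → z∉T∩F (x∈p∩q⁺ (z∈T , z∈F)))
    independent : r T ≡ ∣ T ∣
    independent = ≤-antisym (r-bounded T)
                    (subst (_≤ r T) (trans (cong suc rF≡2) (sym ∣T∣≡3)) r-grows)

  triple∈G : ∀ {x y z} → x ≢ y → x ≢ z → y ≢ z → 𝟙 F x + 𝟙 F y + 𝟙 F z ≡ 2 → G (triple x y z)
  triple∈G x≢y x≢z y≢z two =
    three-two∈G (size-triple x≢y x≢z y≢z) (trans (count-triple F x≢y x≢z y≢z) two)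

  a-witness : Nonempty F
  a-witness = size-nonempty F (≤-trans (s≤s z≤n) 3≤∣F∣)

  a : Fin n
  a = proj₁ a-witness

  a∈F : a ∈ F
  a∈F = proj₂ a-witness

  a'-witness : ∃ λ x → x ∈ F × x ∉ ⁅ a ⁆
  a'-witness = pick-outside F ⁅ a ⁆
    (subst (_< ∣ F ∣) (sym (∣⁅x⁆∣≡1 a)) (≤-trans (n≤1+n 2) 3≤∣F∣))

  a' : Fin n
  a' = proj₁ a'-witness

  a'∈F : a' ∈ F
  a'∈F = proj₁ (proj₂ a'-witness)

  a≢a' : a ≢ a'
  a≢a' a≡a' = x∉⁅y⁆⇒x≢y (proj₂ (proj₂ a'-witness)) (sym a≡a')

  ∁F-witness : Nonempty (∁ F)
  ∁F-witness = complement-nonempty (subst₂ _<_ (sym rF≡2) (sym r⊤≡3) ≤-refl)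

  -- Connectedness: the complement of F cannot have rank 1.
  r∁F≥2 : 2 ≤ r (∁ F)
  r∁F≥2 = +-cancelˡ-≤ 2 2 (r (∁ F))
    (subst₂ (λ u v → u < v + r (∁ F)) r⊤≡3 rF≡2 (connected-complement connected a-witness ∁F-witness))

  c : Fin n
  c = proj₁ ∁F-witness

  c∉F : c ∉ F
  c∉F = x∈∁p⇒x∉p (proj₂ ∁F-witness)

  d-witness : ∃ λ x → x ∈ ∁ F × x ∉ ⁅ c ⁆
  d-witness = pick-outside (∁ F) ⁅ c ⁆
    (subst (_< ∣ ∁ F ∣) (sym (∣⁅x⁆∣≡1 c)) (≤-trans r∁F≥2 (r-bounded (∁ F))))

  d : Fin n
  d = proj₁ d-witness

  d∉F : d ∉ F
  d∉F = x∈∁p⇒x∉p (proj₁ (proj₂ d-witness))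

  c≢d : c ≢ d
  c≢d c≡d = x∉⁅y⁆⇒x≢y (proj₂ (proj₂ d-witness)) (sym c≡d)

  reference∈G : G (triple a a' c)
  reference∈G = triple∈G a≢a' (separated a∈F c∉F) (separated a'∈F c∉F)
    (cong₂ _+_ (cong₂ _+_ (𝟙-∈ a∈F) (𝟙-∈ a'∈F)) (𝟙-∉ c∉F))

  -- Some basis meets F in a single element: {c, d, x} for x = a or x = a'.
  -- Otherwise {c,d,a} and {c,d,a'} both have rank ≤ 2, while their union contains
  -- the basis {a,a',c} and their intersection the independent pair {c,d},
  -- contradicting submodularity (3 + 2 ≤ 2 + 2).
  basis-meeting-F-once : ∃ λ x → x ∈ F × r (triple c d x) ≡ 3
  basis-meeting-F-once with r (triple c d a) ≟ 3 | r (triple c d a') ≟ 3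
  ... | yes r≡3 | _       = a  , a∈F  , r≡3
  ... | no _    | yes r≡3 = a' , a'∈F , r≡3
  ... | no r≢3  | no r'≢3 = contradiction 5≤4 (<⇒≱ (n<1+n 4))
    where
    X Y : Subset n
    X = triple c d a
    Y = triple c d a'
    rank≤2 : ∀ {x} → x ∈ F → r (triple c d x) ≢ 3 → r (triple c d x) ≤ 2
    rank≤2 {x} x∈F r≢3 = m<1+n⇒m≤n (≤∧≢⇒< (subst (r (triple c d x) ≤_) size (r-bounded _)) r≢3)
      where
      size : ∣ triple c d x ∣ ≡ 3
      size = size-triple c≢d (separated x∈F c∉F ∘ sym) (separated x∈F d∉F ∘ sym)
    union-rank : 3 ≤ r (X ∪ Y)
    union-rank = subst (_≤ r (X ∪ Y)) (trans (proj₁ (proj₁ reference∈G)) (trans (proj₂ (proj₁ reference∈G)) r⊤≡3))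
      (r-mono _ _ (triple-⊆ (p⊆p∪q Y third∈triple) (q⊆p∪q X Y third∈triple) (p⊆p∪q Y first∈triple)))
    intersection-rank : 2 ≤ r (X ∩ Y)
    intersection-rank = subst (_≤ r (X ∩ Y)) (proj₂ simple c d c≢d)
      (r-mono _ _ λ x∈cd → x∈p∩q⁺ (p⊆p∪q ⁅ a ⁆ x∈cd , p⊆p∪q ⁅ a' ⁆ x∈cd))
    5≤4 : 5 ≤ 4
    5≤4 = begin
      3 + 2                  ≤⟨ +-mono-≤ union-rank intersection-rank ⟩
      r (X ∪ Y) + r (X ∩ Y)  ≤⟨ r-submod X Y ⟩
      r X + r Y              ≤⟨ +-mono-≤ (rank≤2 a∈F r≢3) (rank≤2 a'∈F r'≢3) ⟩
      2 + 2                  ∎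
      where open ≤-Reasoning

  G-is-face : IsFace M G
  G-is-face = F ∷ [] , λ B → (λ { (basis , tight) → basis , tight ∷ [] })
                           , (λ { (basis , tight ∷ []) → basis , tight })

  G-proper : ¬ (_⊑_ M (IsBasis M) G)
  G-proper every-basis-in-G with basis-meeting-F-once
  ... | x , x∈F , r≡3 = contradiction (trans (sym meets-once) (trans meets-as-G rF≡2)) (λ ())
    where
    c≢x : c ≢ x
    c≢x = separated x∈F c∉F ∘ sym
    d≢x : d ≢ x
    d≢x = separated x∈F d∉F ∘ sym
    size : ∣ triple c d x ∣ ≡ 3
    size = size-triple c≢d c≢x d≢x
    meets-as-G : ∣ triple c d x ∩ F ∣ ≡ r F
    meets-as-G = proj₂ (every-basis-in-G _ (trans r≡3 (sym size) , trans size (sym r⊤≡3)))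
    meets-once : ∣ triple c d x ∩ F ∣ ≡ 1
    meets-once = trans (count-triple F c≢d c≢x d≢x)
                       (cong₂ _+_ (cong₂ _+_ (𝟙-∉ c∉F) (𝟙-∉ d∉F)) (𝟙-∈ x∈F))

  -- Exchanging one element of a member of G for another keeps |B ∩ A| when A is
  -- tight on G, so the two elements are both in A or both outside A.
  exchange : ∀ {A} → TightOnG A → ∀ P {x y} → x ∉ P → y ∉ P →
             G (P ∪ ⁅ x ⁆) → G (P ∪ ⁅ y ⁆) → lookup A x ≡ lookup A y
  exchange {A} tight P {x} {y} x∉P y∉P Gx Gy = 𝟙-injective {A = A} (+-cancelˡ-≡ ∣ P ∩ A ∣ _ _ (begin
    ∣ P ∩ A ∣ + 𝟙 A x     ≡⟨ count-insert P A x x∉P ⟨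
    ∣ (P ∪ ⁅ x ⁆) ∩ A ∣   ≡⟨ tight _ Gx ⟩
    r A                   ≡⟨ tight _ Gy ⟨
    ∣ (P ∪ ⁅ y ⁆) ∩ A ∣   ≡⟨ count-insert P A y y∉P ⟩
    ∣ P ∩ A ∣ + 𝟙 A y     ∎))
    where open ≡-Reasoning

  -- On F, membership in a tight set agrees with that of a: compare {y, c, x} and
  -- {y, c, a} for a third element y of F.
  constant-on-F : ∀ {A} → TightOnG A → ∀ x → x ∈ F → lookup A x ≡ lookup A a
  constant-on-F tight x x∈F with pick-third F x a 3≤∣F∣
  ... | y , y∈F , y≢x , y≢a = exchange tight (⁅ y ⁆ ∪ ⁅ c ⁆)
    (∉-pair (y≢x ∘ sym) (separated x∈F c∉F)) (∉-pair (y≢a ∘ sym) (separated a∈F c∉F))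
    (with-y-c x∈F (y≢x ∘ sym)) (with-y-c a∈F (y≢a ∘ sym))
    where
    with-y-c : ∀ {z} → z ∈ F → z ≢ y → G (triple y c z)
    with-y-c {z} z∈F z≢y = triple∈G (separated y∈F c∉F) (z≢y ∘ sym) (separated z∈F c∉F ∘ sym)
      (cong₂ _+_ (cong₂ _+_ (𝟙-∈ y∈F) (𝟙-∉ c∉F)) (𝟙-∈ z∈F))

  -- Off F, membership in a tight set agrees with that of c: compare {a, a', z}
  -- with the reference basis {a, a', c}.
  constant-off-F : ∀ {A} → TightOnG A → ∀ z → z ∉ F → lookup A z ≡ lookup A c
  constant-off-F tight z z∉F = exchange tight (⁅ a ⁆ ∪ ⁅ a' ⁆)
    (∉-pair (separated a∈F z∉F ∘ sym) (separated a'∈F z∉F ∘ sym))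
    (∉-pair (separated a∈F c∉F ∘ sym) (separated a'∈F c∉F ∘ sym))
    (triple∈G a≢a' (separated a∈F z∉F) (separated a'∈F z∉F)
      (cong₂ _+_ (cong₂ _+_ (𝟙-∈ a∈F) (𝟙-∈ a'∈F)) (𝟙-∉ z∉F)))
    reference∈G

  -- E ∖ F is not tight on G: it meets the reference basis once, but has rank ≥ 2.
  complement-not-tight : ¬ TightOnG (∁ F)
  complement-not-tight tight = <⇒≢ r∁F≥2 (sym (trans (sym (tight _ reference∈G)) meets-once))
    where
    meets-once : ∣ triple a a' c ∩ ∁ F ∣ ≡ 1
    meets-once = trans (count-triple (∁ F) a≢a' (separated a∈F c∉F) (separated a'∈F c∉F))
      (cong₂ _+_ (cong₂ _+_ (𝟙-∉ (x∈p⇒x∉∁p a∈F)) (𝟙-∉ (x∈p⇒x∉∁p a'∈F))) (𝟙-∈ (x∉p⇒x∈∁p c∉F)))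

  tight-sets : ∀ {A} → TightOnG A → A ≡ ⊥ ⊎ A ≡ ⊤ ⊎ A ≡ F
  tight-sets {A} tight =
    [ inj₁
    , [ inj₂ ∘ inj₁
      , [ inj₂ ∘ inj₂
        , (λ A≡∁F → contradiction (subst TightOnG A≡∁F tight) complement-not-tight) ]′ ]′ ]′
      (profile-classify F A (lookup A a) (lookup A c) (constant-on-F tight , constant-off-F tight))

  TightOnBases : Subset n → Set
  TightOnBases A = ∀ B → IsBasis M B → Tight B A

  -- ∅ and E are tight on every basis (r(∅) = 0 and |B| = r(E)).
  ∅-tight : TightOnBases ⊥
  ∅-tight B _ = trans (cong ∣_∣ (∩-zeroʳ B)) (trans (∣⊥∣≡0 n) (sym r-⊥))

  E-tight : TightOnBases ⊤
  E-tight B B-basis = trans (cong ∣_∣ (∩-identityʳ B)) (proj₂ B-basis)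

  forces-G-or-trivial : ∀ {A B} → TightOnG A → IsBasis M B → Tight B A → G B ⊎ TightOnBases A
  forces-G-or-trivial {A} {B} A-tight B-basis B-tight =
    [ (λ A≡⊥ → inj₂ (subst TightOnBases (sym A≡⊥) ∅-tight))
    , [ (λ A≡⊤ → inj₂ (subst TightOnBases (sym A≡⊤) E-tight))
      , (λ A≡F → inj₁ (B-basis , subst (Tight B) A≡F B-tight)) ]′ ]′
      (tight-sets A-tight)

  -- Maximality: a proper face ℋ containing G is cut out by sets tight on G.
  -- If none of them forced B ∈ ℋ into G, all would be tight on every basis and
  -- ℋ would contain all of 𝓑(M).
  G-maximal : ∀ ℋ → IsProperFace M ℋ → _⊑_ M G ℋ → _⊑_ M ℋ G
  G-maximal ℋ ((As , ℋ-is-face) , ℋ-proper) G⊑ℋ B B∈ℋ =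
    [ id , (λ all-trivial → contradiction (every-basis-in-ℋ all-trivial) ℋ-proper) ]′
      (all-or-witness (All.tabulate per-set))
    where
    tight-in-ℋ : ∀ {B'} → ℋ B' → All (Tight B') As
    tight-in-ℋ {B'} B'∈ℋ = proj₂ (proj₁ (ℋ-is-face B') B'∈ℋ)
    per-set : ∀ {A} → A ∈ₗ As → G B ⊎ TightOnBases A
    per-set A∈As = forces-G-or-trivial (λ B' B'∈G → All.lookup (tight-in-ℋ (G⊑ℋ B' B'∈G)) A∈As)
      (proj₁ (proj₁ (ℋ-is-face B) B∈ℋ)) (All.lookup (tight-in-ℋ B∈ℋ) A∈As)
    every-basis-in-ℋ : All TightOnBases As → _⊑_ M (IsBasis M) ℋ
    every-basis-in-ℋ all-trivial B' B'-basis =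
      proj₂ (ℋ-is-face B') (B'-basis , All.map (λ trivial → trivial B' B'-basis) all-trivial)

proposition4p4 : (n : ℕ) (M : Matroid n) → Connected M → Simple M → rankM M ≡ 3 →
    (F : Subset n) → IsFlat M F → Matroid.r M F ≡ 2 → 3 ≤ ∣ F ∣ → FacetDefining M F
proposition4p4 n M connected simple r⊤≡3 F flat rF≡2 3≤∣F∣ = (G-is-face , G-proper) , G-maximal
  where open RankTwoFlat M connected simple r⊤≡3 F flat rF≡2 3≤∣F∣
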